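{- Let $G$ be a finite simple graph with a planar embedding satisfying: (1) $G$ is 2-connected and every face of the embedding has size at most 6; (2) the outer face of the embedding is bounded by a quadrilateral on four vertices $x,y,z,w$ in this cyclic order, and $x$ and $z$ have degree 2; (3) every vertex in $V(G)\setminus\{x,z\}$ has degree 3. Then $G$ has a Hamiltonian path whose endpoints are $x$ and $z$.
   Context: All graphs are finite, simple and undirected. The size of a face is the number of edges on its boundary. The outer face of a planar embedding is its unique unbounded face. -}

module Defs where

open import Data.Nat using (ℕ; zero; suc; _+_; _*_; _<ᵇ_; _≤ᵇ_; _≤_)
open import Data.Bool using (Bool; true; false; T; _∧_)
open import Data.Empty using (⊥)
open import Data.Unit using (⊤)
open import Data.Fin using (Fin; toℕ)
open import Data.Product using (Σ; _×_; _,_; ∃; proj₁; proj₂)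
open import Data.List using (List; []; _∷_; length; filterᵇ; allFin; cartesianProduct; upTo; _∷ʳ_)
open import Data.List.Membership.Propositional using (_∈_)
open import Data.List.Relation.Unary.Unique.Propositional using (Unique)
open import Data.List.Relation.Unary.Linked using (Linked)
open import Relation.Binary.PropositionalEquality using (_≡_; _≢_)

iter : {A : Set} → (A → A) → ℕ → A → A
iter f zero    a = a
iter f (suc k) a = f (iter f k a)

allᵇ : {A : Set} → (A → Bool) → List A → Bool
allᵇ p []       = true
allᵇ p (x ∷ xs) = p x ∧ allᵇ p xs

countᵇ : {A : Set} → (A → Bool) → List A → ℕ
countᵇ p xs = length (filterᵇ p xs)

record Graph (n : ℕ) : Set where
  field
    adj     : Fin n → Fin n → Bool
    adj-sym : ∀ u v → T (adj u v) → T (adj v u)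
    irrefl  : ∀ v → T (adj v v) → ⊥

  Adj : Fin n → Fin n → Set
  Adj u v = T (adj u v)

  deg : Fin n → ℕ
  deg v = countᵇ (adj v) (allFin n)

  -- darts = ordered pairs of vertices (only adjacent ones are relevant)
  allPairs : List (Fin n × Fin n)
  allPairs = cartesianProduct (allFin n) (allFin n)

  numEdges : ℕ
  numEdges = countᵇ (λ d → (toℕ (proj₁ d) <ᵇ toℕ (proj₂ d)) ∧ adj (proj₁ d) (proj₂ d)) allPairs

open Graph public

data Walk {n : ℕ} (G : Graph n) (ok : Fin n → Set) : Fin n → Fin n → Set where
  here : ∀ {v} → ok v → Walk G ok v v
  step : ∀ {u w v} → ok u → Adj G u w → Walk G ok w v → Walk G ok u v

Connected : {n : ℕ} → Graph n → Set
Connected {n} G = ∀ (a b : Fin n) → Walk G (λ _ → ⊤) a b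

ConnectedWithout : {n : ℕ} → Graph n → Fin n → Set
ConnectedWithout {n} G v =
  ∀ (a b : Fin n) → a ≢ v → b ≢ v → Walk G (λ u → u ≢ v) a b

TwoConnected : {n : ℕ} → Graph n → Set
TwoConnected {n} G = (3 ≤ n) × Connected G × (∀ v → ConnectedWithout G v)

-- A rotation system: for each vertex v, a cyclic permutation 'rot v'
-- of the neighbourhood of v (the clockwise order of edges around v).
record RotationSystem {n : ℕ} (G : Graph n) : Set where
  field
    rot     : Fin n → Fin n → Fin n
    rot-adj : ∀ v u → Adj G v u → Adj G v (rot v u)
    rot-inj : ∀ v u u' → Adj G v u → Adj G v u' → rot v u ≡ rot v u' → u ≡ u'
    rot-cyc : ∀ v u w → Adj G v u → Adj G v w → ∃ λ k → iter (rot v) k u ≡ w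

  -- face-tracing permutation on darts: after traversing u → v, leave v
  -- along the edge following vu in the rotation at v
  faceNext : Fin n × Fin n → Fin n × Fin n
  faceNext (u , v) = (v , rot v u)

  -- a dart is the representative of its face if it is the
  -- lexicographically least dart in its faceNext-orbit
  key : Fin n × Fin n → ℕ
  key (u , v) = toℕ u * n + toℕ v

  isFaceRep : Fin n × Fin n → Bool
  isFaceRep d = allᵇ (λ k → key d ≤ᵇ key (iter faceNext k d)) (upTo (n * n))

  numFaces : ℕ
  numFaces = countᵇ (λ d → adj G (proj₁ d) (proj₂ d) ∧ isFaceRep d) (allPairs G)

  -- the embedding (of a connected graph) is planar iff Euler's formula
  -- V - E + F = 2 holds (genus 0)
  Planar : Set
  Planar = n + numFaces ≡ numEdges G + 2

  FacesAtMost : ℕ → Set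
  FacesAtMost m = ∀ u v → Adj G u v →
    ∃ λ k → (1 ≤ k) × (k ≤ m) × (iter faceNext k (u , v) ≡ (u , v))

  QuadFace : Fin n → Fin n → Fin n → Fin n → Set
  QuadFace x y z w =
    (x ≢ y) × (x ≢ z) × (x ≢ w) × (y ≢ z) × (y ≢ w) × (z ≢ w) ×
    Adj G x y × Adj G y z × Adj G z w × Adj G w x ×
    (faceNext (x , y) ≡ (y , z)) × (faceNext (y , z) ≡ (z , w)) ×
    (faceNext (z , w) ≡ (w , x)) × (faceNext (w , x) ≡ (x , y))

open RotationSystem public

-- A plane embedding of G with a distinguished outer face: a planar
-- rotation system together with a dart on the outer face.
record PlaneEmbedding {n : ℕ} (G : Graph n) : Set where
  field
    rs     : RotationSystem G
    planar : Planar rs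
    outer  : Fin n × Fin n
    outer-adj : Adj G (proj₁ outer) (proj₂ outer)

open PlaneEmbedding public

HamiltonianPath : {n : ℕ} → Graph n → Fin n → Fin n → Set
HamiltonianPath {n} G x z =
  Σ (List (Fin n)) λ p →
    Unique p × (∀ v → v ∈ p) × Linked (Adj G) p ×
    (∃ λ mid → p ≡ x ∷ (mid ∷ʳ z))

{-# OPTIONS --safe #-}
module Submission where

-- Peel G from the outside.  In the current quadrilateral p q r s (first x y z w) the corners
-- p and r have no further neighbours among the vertices not yet placed, and q, s are cubic
-- with third neighbours q′, s′.  If s′ = q the path is p q s r.  Otherwise consider the faces
-- through q p s and through s r q, each with at most six sides: a triangle or quadrangle
-- would identify two of q, s, q′, s′; two pentagons clash in the rotation at s′; q′ = s′, or a
-- pentagon beside a hexagon, joins the vertices seen so far to the rest by a single edge,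
-- whose far end is then a cut vertex.  So both faces are hexagons p s s′ t q′ q and
-- r q q′ t′ s′ s, the quadrilateral q′ t′ s′ t satisfies the same hypotheses in what is left,
-- and a Hamiltonian q′–s′ path there extends to p q … s r.

open import Defs
open import Data.Empty using (⊥; ⊥-elim)
open import Data.Fin using (Fin; _≟_)
open import Data.List using (List; []; _∷_; _∷ʳ_; _++_; length; filterᵇ; allFin)
open import Data.List.Properties using (++-assoc; ++-identityʳ; length-tabulate)
open import Data.List.Membership.Propositional using (_∈_; _∉_)
open import Data.List.Membership.Propositional.Properties
  using (∈-++⁺ˡ; ∈-++⁺ʳ; ∈-++⁻; ∈-∃++; ∈-filter⁺; ∈-filter⁻; ∈-allFin)
import Data.List.Membership.DecPropositional as DecMembership
open import Data.List.Relation.Binary.Subset.Propositional using (_⊆_)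
import Data.List.Relation.Binary.Permutation.Setoid as Permutation
import Data.List.Relation.Binary.Permutation.Setoid.Properties as PermutationProperties
open import Data.List.Relation.Unary.All as All using (All; []; _∷_)
open import Data.List.Relation.Unary.All.Properties using (¬Any⇒All¬)
open import Data.List.Relation.Unary.AllPairs as AllPairs using ([]; _∷_)
open import Data.List.Relation.Unary.Any using (here; there)
open import Data.List.Relation.Unary.Linked using (Linked; []; [-]; _∷_)
open import Data.List.Relation.Unary.Unique.Propositional using (Unique)
open import Data.List.Relation.Unary.Unique.Propositional.Properties
  using (Unique[x∷xs]⇒x∉xs; allFin⁺; filter⁺)
open import Data.Nat using (ℕ; zero; suc; _+_; _≤_; z≤n; s≤s)
open import Data.Nat.Properties
  using (≤-refl; ≤-trans; ≤-reflexive; +-suc; +-identityʳ; m≤n+m; 1+n≰n)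
open import Data.Product using (_×_; _,_; proj₁; proj₂; ∃)
open import Data.Sum using (_⊎_; inj₁; inj₂)
open import Data.Unit using (⊤)
open import Function using (_∘_; id)
open import Relation.Binary.PropositionalEquality
  using (_≡_; _≢_; refl; sym; trans; cong; subst; setoid)
open import Relation.Nullary using (¬_; contradiction)
open import Relation.Nullary.Decidable using (T?; yes; no)

module _ {A : Set} where
  open Permutation (setoid A) using (↭-sym)
  open PermutationProperties (setoid A)
    using (↭-shift; xs↭ys⇒|xs|≡|ys|; Unique-resp-↭; ∈-resp-↭)

  length-mono-⊆ : {xs ys : List A} → Unique xs → xs ⊆ ys → length xs ≤ length ys
  length-mono-⊆ {[]} _ _ = z≤n
  length-mono-⊆ {x ∷ xs} {ys} x∷xs!@(_ ∷ xs!) x∷xs⊆ys with ∈-∃++ (x∷xs⊆ys (here refl))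
  ... | ys₁ , ys₂ , refl = ≤-trans (s≤s (length-mono-⊆ xs! xs⊆ys₁ys₂))
                                   (≤-reflexive (xs↭ys⇒|xs|≡|ys| (↭-sym (↭-shift ys₁ ys₂))))
    where
    xs⊆ys₁ys₂ : xs ⊆ ys₁ ++ ys₂
    xs⊆ys₁ys₂ {z} z∈xs with ∈-++⁻ ys₁ (x∷xs⊆ys (there z∈xs))
    ... | inj₁ z∈ys₁ = ∈-++⁺ˡ z∈ys₁
    ... | inj₂ (here refl) = contradiction z∈xs (Unique[x∷xs]⇒x∉xs x∷xs!)
    ... | inj₂ (there z∈ys₂) = ∈-++⁺ʳ ys₁ z∈ys₂

  iter-fixed : {f : A → A} {a : A} → f a ≡ a → ∀ k → iter f k a ≡ a
  iter-fixed fa≡a zero = refl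
  iter-fixed {f} fa≡a (suc k) = trans (cong f (iter-fixed fa≡a k)) fa≡a

  iter-period₂ : {f : A → A} {a : A} → f (f a) ≡ a → ∀ k → iter f k a ∈ a ∷ f a ∷ []
  iter-period₂ ffa≡a zero = here refl
  iter-period₂ {f} ffa≡a (suc k) with iter-period₂ ffa≡a k
  ... | here e = there (here (cong f e))
  ... | there (here e) = here (trans (cong f e) ffa≡a)

  Linked-∷ʳ : {R : A → A → Set} (xs : List A) {y z : A} →
              Linked R (xs ∷ʳ y) → R y z → Linked R (xs ∷ʳ y ∷ʳ z)
  Linked-∷ʳ [] _ Ryz = Ryz ∷ [-]
  Linked-∷ʳ (x ∷ []) (Rxy ∷ _) Ryz = Rxy ∷ Ryz ∷ [-]
  Linked-∷ʳ (x ∷ x′ ∷ xs) (Rxx′ ∷ l) Ryz = Rxx′ ∷ Linked-∷ʳ (x′ ∷ xs) l Ryz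

  record HamiltonianPathOutside (R : A → A → Set) (Out : List A) (a b : A) : Set where
    field
      inner : List A

    path : List A
    path = a ∷ (inner ∷ʳ b)

    field
      linked : Linked R path
      unique : Unique (path ++ Out)
      covers : ∀ v → v ∈ path ++ Out

  module _ {R : A → A → Set} where

    prepend : ∀ {x a b Out} → R x a →
              HamiltonianPathOutside R (x ∷ Out) a b → HamiltonianPathOutside R Out x b
    prepend {x} {a} {b} {Out} Rxa P = record
      { inner = a ∷ inner
      ; linked = Rxa ∷ linked
      ; unique = Unique-resp-↭ shifted unique
      ; covers = λ v → ∈-resp-↭ shifted (covers v)
      }
      where
      open HamiltonianPathOutside P
      shifted = ↭-shift path Out

    append : ∀ {x a b Out} → R b x →
             HamiltonianPathOutside R (x ∷ Out) a b → HamiltonianPathOutside R Out a x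
    append {x} {a} {b} {Out} Rbx P = record
      { inner = inner ∷ʳ b
      ; linked = Linked-∷ʳ (a ∷ inner) linked Rbx
      ; unique = subst Unique (sym (++-assoc path _ Out)) unique
      ; covers = λ v → subst (v ∈_) (sym (++-assoc path _ Out)) (covers v)
      }
      where
      open HamiltonianPathOutside P

HamiltonianPathOutside⇒HamiltonianPath : ∀ {n} (G : Graph n) {a b} →
  HamiltonianPathOutside (Adj G) [] a b → HamiltonianPath G a b
HamiltonianPathOutside⇒HamiltonianPath G P =
  path , subst Unique (++-identityʳ path) unique ,
  (λ v → subst (v ∈_) (++-identityʳ path) (covers v)) , linked , inner , refl
  where open HamiltonianPathOutside P

length-Unique-Fin : ∀ {n} {xs : List (Fin n)} → Unique xs → length xs ≤ n
length-Unique-Fin {n} xs! =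
  ≤-trans (length-mono-⊆ xs! (λ {i} _ → ∈-allFin i)) (≤-reflexive (length-tabulate id))

module Neighbourhoods {n : ℕ} (G : Graph n) where
  open DecMembership (_≟_ {n}) using (_∈?_)

  Adj-sym : ∀ {u v} → Adj G u v → Adj G v u
  Adj-sym {u} {v} = adj-sym G u v

  Adj-irrefl : ∀ {u v} → Adj G u v → u ≢ v
  Adj-irrefl {u} uu refl = irrefl G u uu

  walk-start : ∀ {ok a b} → Walk G ok a b → ok a
  walk-start (here ok-a) = ok-a
  walk-start (step ok-a _ _) = ok-a

  closed-along-walk : ∀ {ok} (S : Fin n → Set) → (∀ {a b} → S a → ok b → Adj G a b → S b) →
                      ∀ {a b} → Walk G ok a b → S a → S b
  closed-along-walk S closed (here _) Sa = Sa
  closed-along-walk S closed (step _ ab w) Sa =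
    closed-along-walk S closed w (closed Sa (walk-start w) ab)

  neighbours : Fin n → List (Fin n)
  neighbours v = filterᵇ (adj G v) (allFin n)

  ∈-neighbours : ∀ {v u} → Adj G v u → u ∈ neighbours v
  ∈-neighbours {v} {u} vu = ∈-filter⁺ (T? ∘ adj G v) (∈-allFin u) vu

  ∈-neighbours⁻ : ∀ {v u} → u ∈ neighbours v → Adj G v u
  ∈-neighbours⁻ {v} u∈ = proj₂ (∈-filter⁻ (T? ∘ adj G v) {xs = allFin n} u∈)

  neighbours-unique : ∀ v → Unique (neighbours v)
  neighbours-unique v = filter⁺ (T? ∘ adj G v) (allFin⁺ n)

  deg-≤ : ∀ {v ys} → (∀ {u} → Adj G v u → u ∈ ys) → deg G v ≤ length ys
  deg-≤ {v} ⊆ys = length-mono-⊆ (neighbours-unique v) (⊆ys ∘ ∈-neighbours⁻)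

  ≤-deg : ∀ {v xs} → Unique xs → All (Adj G v) xs → length xs ≤ deg G v
  ≤-deg {v} xs! v~xs = length-mono-⊆ xs! (∈-neighbours ∘ All.lookup v~xs)

  all-neighbours : ∀ {v xs u} → Unique xs → All (Adj G v) xs → deg G v ≤ length xs →
                   Adj G v u → u ∈ xs
  all-neighbours {v} {xs} {u} xs! v~xs deg≤ vu with u ∈? xs
  ... | yes u∈xs = u∈xs
  ... | no u∉xs = ⊥-elim (1+n≰n (≤-trans (≤-deg (¬Any⇒All¬ xs u∉xs ∷ xs!) (vu ∷ v~xs)) deg≤))

  neighbour₃ : ∀ {v a b c u} → deg G v ≡ 3 → a ≢ b → a ≢ c → b ≢ c →
               Adj G v a → Adj G v b → Adj G v c → Adj G v u → u ∈ a ∷ b ∷ c ∷ []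
  neighbour₃ deg≡3 a≢b a≢c b≢c va vb vc =
    all-neighbours ((a≢b ∷ a≢c ∷ []) ∷ (b≢c ∷ []) ∷ [] ∷ [])
                   (va ∷ vb ∷ vc ∷ []) (≤-reflexive deg≡3)

module Rotations {n : ℕ} {G : Graph n} (R : RotationSystem G) where
  open Neighbourhoods G
  open RotationSystem R using () renaming (rot to ρ; faceNext to next)

  rot-Adj : ∀ {v a b} → Adj G v a → ρ v a ≡ b → Adj G v b
  rot-Adj {v} {a} va refl = rot-adj R v a va

  Adj-next : ∀ {u v w} → Adj G u v → ρ v u ≡ w → Adj G v w
  Adj-next uv = rot-Adj (Adj-sym uv)

  rot-injective : ∀ {v a b} → Adj G v a → Adj G v b → ρ v a ≡ ρ v b → a ≡ b
  rot-injective {v} {a} {b} = rot-inj R v a b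

  record Rotation₃ (v a b c : Fin n) : Set where
    field
      a≢b : a ≢ b
      a≢c : a ≢ c
      b≢c : b ≢ c
      ρc≡a : ρ v c ≡ a
      neighbour : ∀ {u} → Adj G v u → u ∈ a ∷ b ∷ c ∷ []

  rotation₃ : ∀ {v a b c} → deg G v ≡ 3 → Adj G v a → ρ v a ≡ b → ρ v b ≡ c →
              Rotation₃ v a b c
  rotation₃ {v} {a} {b} {c} deg≡3 va ρa≡b ρb≡c =
    record { a≢b = a≢b ; a≢c = a≢c ; b≢c = b≢c ; ρc≡a = ρc≡a ; neighbour = neighbour }
    where
    vb = rot-Adj va ρa≡b
    vc = rot-Adj vb ρb≡c

    orbit-⊆ : ∀ {xs} → (∀ k → iter (ρ v) k a ∈ xs) → 3 ≤ length xs
    orbit-⊆ {xs} orbit∈xs = subst (_≤ length xs) deg≡3 (deg-≤ λ {u} vu →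
      let k , ρᵏa≡u = rot-cyc R v a u va vu in subst (_∈ xs) ρᵏa≡u (orbit∈xs k))

    a≢b : a ≢ b
    a≢b refl with orbit-⊆ {a ∷ []} (λ k → here (iter-fixed ρa≡b k))
    ... | s≤s ()

    a≢c : a ≢ c
    a≢c refl with orbit-⊆ {a ∷ ρ v a ∷ []} (iter-period₂ (trans (cong (ρ v) ρa≡b) ρb≡c))
    ... | s≤s (s≤s ())

    b≢c : b ≢ c
    b≢c b≡c = a≢b (rot-injective va vb (trans ρa≡b (trans b≡c (sym ρb≡c))))

    neighbour : ∀ {u} → Adj G v u → u ∈ a ∷ b ∷ c ∷ []
    neighbour = neighbour₃ deg≡3 a≢b a≢c b≢c va vb vc

    ρc≡a : ρ v c ≡ a
    ρc≡a with neighbour (rot-Adj vc refl)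
    ... | here ρc≡a = ρc≡a
    ... | there (here ρc≡b) =
      ⊥-elim (a≢c (sym (rot-injective vc va (trans ρc≡b (sym ρa≡b)))))
    ... | there (there (here ρc≡c)) =
      ⊥-elim (b≢c (sym (rot-injective vc vb (trans ρc≡c (sym ρb≡c)))))

  third-neighbour : ∀ {v a b} → deg G v ≡ 3 → Adj G v a → Adj G v b → a ≢ b →
                    ∃ λ c → Adj G v c × c ≢ a × c ≢ b
  third-neighbour {v} {a} {b} deg≡3 va vb a≢b
    with Rotation₃.neighbour (rotation₃ deg≡3 va refl refl) vb
  ... | here b≡a = ⊥-elim (a≢b (sym b≡a))
  ... | there (here b≡ρa) =
    ρ v (ρ v a) , rot-Adj (rot-Adj va refl) refl , a≢c ∘ sym , λ c≡b → b≢c (sym (trans c≡b b≡ρa))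
    where open Rotation₃ (rotation₃ deg≡3 va refl refl) using (a≢c; b≢c)
  ... | there (there (here b≡ρρa)) =
    ρ v a , rot-Adj va refl , a≢ρa ∘ sym , λ c≡b → b≢c (trans c≡b b≡ρρa)
    where open Rotation₃ (rotation₃ deg≡3 va refl refl) using (b≢c) renaming (a≢b to a≢ρa)

  IsEdge : Fin n × Fin n → Set
  IsEdge (u , v) = Adj G u v

  next-IsEdge : ∀ {d} → IsEdge d → IsEdge (next d)
  next-IsEdge uv = Adj-next uv refl

  iter-next-IsEdge : ∀ {d} → IsEdge d → ∀ k → IsEdge (iter next k d)
  iter-next-IsEdge d zero = d
  iter-next-IsEdge d (suc k) = next-IsEdge (iter-next-IsEdge d k)

  next-injective : ∀ {d e} → IsEdge d → IsEdge e → next d ≡ next e → d ≡ e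
  next-injective {u , v} uv u′v′ eq with cong proj₁ eq
  ... | refl = cong (_, v) (rot-injective (Adj-sym uv) (Adj-sym u′v′) (cong proj₂ eq))

  two-before : ∀ {c′ c a b} → Adj G c′ c → ρ c c′ ≡ a → ρ a c ≡ b → ∀ j →
               iter next (2 + j) (a , b) ≡ (a , b) → iter next j (a , b) ≡ (c′ , c)
  two-before c′c refl refl j eq =
    next-injective dⱼ c′c (next-injective (next-IsEdge dⱼ) (next-IsEdge c′c) eq)
    where dⱼ = iter-next-IsEdge (next-IsEdge (next-IsEdge c′c)) j

  -- The face whose boundary walk passes c′ → c → a → b → ρ b a, by its length.
  data SmallFace (c′ c a b : Fin n) : Set where
    triangle   : ρ b a ≡ c → SmallFace c′ c a b
    quadrangle : ρ b a ≡ c′ → SmallFace c′ c a b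
    pentagon   : ρ (ρ b a) b ≡ c′ → ρ c′ (ρ b a) ≡ c → SmallFace c′ c a b
    hexagon    : ∀ t → ρ (ρ b a) b ≡ t → ρ t (ρ b a) ≡ c′ → ρ c′ t ≡ c → SmallFace c′ c a b

  small-face : ∀ {c′ c a b} → FacesAtMost R 6 → Adj G c′ c → ρ c c′ ≡ a → ρ a c ≡ b → b ≢ c →
               SmallFace c′ c a b
  small-face {c′} {c} {a} {b} faces≤6 c′c c′ca cab b≢c with faces≤6 a b ab
    where ab = Adj-next (Adj-next c′c c′ca) cab
  ... | 0 , () , _
  ... | 1 , _ , _ , eq =
    ⊥-elim (Adj-irrefl (Adj-next (Adj-next c′c c′ca) cab) (sym (cong proj₁ eq)))
  ... | 2 , _ , _ , eq = ⊥-elim (b≢c (cong proj₂ (two-before c′c c′ca cab 0 eq)))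
  ... | 3 , _ , _ , eq = triangle (cong proj₂ (two-before c′c c′ca cab 1 eq))
  ... | 4 , _ , _ , eq = quadrangle (cong proj₁ (two-before c′c c′ca cab 2 eq))
  ... | 5 , _ , _ , eq with two-before c′c c′ca cab 3 eq
  ...   | refl = pentagon refl refl
  small-face faces≤6 c′c c′ca cab b≢c | 6 , _ , _ , eq with two-before c′c c′ca cab 4 eq
  ...   | refl = hexagon _ refl refl refl
  small-face faces≤6 c′c c′ca cab b≢c | suc (suc (suc (suc (suc (suc (suc _)))))) , _ ,
    s≤s (s≤s (s≤s (s≤s (s≤s (s≤s ()))))) , _

module Separations {n : ℕ} {G : Graph n} (R : RotationSystem G)
                   (no-cut-vertex : ∀ v → ConnectedWithout G v) where
  open Neighbourhoods G
  open Rotations R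
  open RotationSystem R using () renaming (rot to ρ)

  no-bridge : ∀ {u v w} (S : Fin n → Set) → S u → ¬ S v → Adj G v w → w ≢ u →
              (∀ {a b} → S a → Adj G a b → S b ⊎ (a ≡ u × b ≡ v)) → ⊥
  no-bridge {u} {v} {w} S Su ¬Sv vw w≢u leaves = ¬Sw (closed-along-walk S stay walk Su)
    where
    ¬Sw : ¬ S w
    ¬Sw Sw with leaves Sw (Adj-sym vw)
    ... | inj₁ Sv = ¬Sv Sv
    ... | inj₂ (w≡u , _) = w≢u w≡u
    walk : Walk G (_≢ v) u w
    walk = no-cut-vertex v u w (λ { refl → ¬Sv Su }) (Adj-irrefl vw ∘ sym)
    stay : ∀ {a b} → S a → b ≢ v → Adj G a b → S b
    stay Sa b≢v ab with leaves Sa ab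
    ... | inj₁ Sb = Sb
    ... | inj₂ (_ , b≡v) = ⊥-elim (b≢v b≡v)

  -- The third neighbour of u would be a cut vertex.
  no-cubic-attachment : ∀ {u a b} (S : Fin n → Set) → (∀ {v} → ¬ S v → deg G v ≡ 3) →
                        S a → S b → a ≢ b → ¬ S u → Adj G u a → Adj G u b →
                        (∀ {c d} → S c → Adj G c d → S d ⊎ (d ≡ u × c ∈ a ∷ b ∷ [])) → ⊥
  no-cubic-attachment {u} {a} {b} S cubic Sa Sb a≢b ¬Su ua ub leaves
    with third-neighbour (cubic ¬Su) ua ub a≢b
  ... | v , uv , v≢a , v≢b =
    no-bridge S⁺ (inj₂ refl) ¬S⁺v (Adj-next uv refl) (Rotation₃.a≢b v-rotation ∘ sym) leaves⁺
    where
    S⁺ : Fin n → Set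
    S⁺ x = S x ⊎ x ≡ u
    ¬S⁺v : ¬ S⁺ v
    ¬S⁺v (inj₁ Sv) with leaves Sv (Adj-sym uv)
    ... | inj₁ Su = ¬Su Su
    ... | inj₂ (_ , here v≡a) = v≢a v≡a
    ... | inj₂ (_ , there (here v≡b)) = v≢b v≡b
    ¬S⁺v (inj₂ v≡u) = Adj-irrefl uv (sym v≡u)
    v-rotation = rotation₃ (cubic (¬S⁺v ∘ inj₁)) (Adj-sym uv) refl refl
    leaves⁺ : ∀ {c d} → S⁺ c → Adj G c d → S⁺ d ⊎ (c ≡ u × d ≡ v)
    leaves⁺ (inj₁ Sc) cd with leaves Sc cd
    ... | inj₁ Sd = inj₁ (inj₁ Sd)
    ... | inj₂ (d≡u , _) = inj₁ (inj₂ d≡u)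
    leaves⁺ (inj₂ refl) ud
      with neighbour₃ (cubic ¬Su) a≢b (v≢a ∘ sym) (v≢b ∘ sym) ua ub uv ud
    ... | here refl = inj₁ (inj₁ Sa)
    ... | there (here refl) = inj₁ (inj₁ Sb)
    ... | there (there (here d≡v)) = inj₂ (refl , d≡v)

module Frames {n : ℕ} (G : Graph n) (R : RotationSystem G) (connected : Connected G)
              (no-cut-vertex : ∀ v → ConnectedWithout G v) (faces≤6 : FacesAtMost R 6) where
  open Neighbourhoods G
  open Rotations R
  open Separations R no-cut-vertex
  open RotationSystem R using () renaming (rot to ρ)

  PathOutside : List (Fin n) → Fin n → Fin n → Set
  PathOutside = HamiltonianPathOutside (Adj G)

  -- The hypotheses of the theorem for G − Out, with p q r s in the roles of x y z w;
  -- Out is attached to the rest of G only at p and r.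
  record Frame (Out : List (Fin n)) (p q r s : Fin n) : Set where
    field
      p~q : Adj G p q
      q~r : Adj G q r
      r~s : Adj G r s
      s~p : Adj G s p
      ρpq : ρ p q ≡ s
      ρqp : ρ q p ≡ r
      ρrs : ρ r s ≡ q
      ρsr : ρ s r ≡ p
      unique : Unique (q ∷ s ∷ p ∷ r ∷ Out)
      p-neighbour : ∀ {b} → Adj G p b → b ∈ q ∷ s ∷ Out
      r-neighbour : ∀ {b} → Adj G r b → b ∈ q ∷ s ∷ Out
      Out-neighbour : ∀ {a b} → a ∈ Out → Adj G a b → b ∈ p ∷ r ∷ Out
      cubic : ∀ {v} → v ∉ p ∷ r ∷ Out → deg G v ≡ 3

  module Step {Out p q r s} (F : Frame Out p q r s) where
    open Frame F
    open Rotation₃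

    Out⁺ : List (Fin n)
    Out⁺ = q ∷ s ∷ p ∷ r ∷ Out

    q′ s′ : Fin n
    q′ = ρ q r
    s′ = ρ s p

    q∉ : q ∉ s ∷ p ∷ r ∷ Out
    q∉ = Unique[x∷xs]⇒x∉xs unique

    s∉ : s ∉ p ∷ r ∷ Out
    s∉ = Unique[x∷xs]⇒x∉xs (AllPairs.tail unique)

    q≢s : q ≢ s
    q≢s = q∉ ∘ here

    cubic⁺ : ∀ {v} → v ∉ Out⁺ → deg G v ≡ 3
    cubic⁺ v∉ = cubic (v∉ ∘ there ∘ there)

    q-rotation : Rotation₃ q p r q′
    q-rotation = rotation₃ (cubic (q∉ ∘ there)) (Adj-sym p~q) ρqp refl

    s-rotation : Rotation₃ s r p s′
    s-rotation = rotation₃ (cubic s∉) (Adj-sym r~s) ρsr refl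

    q~q′ : Adj G q q′
    q~q′ = rot-Adj q~r refl

    s~s′ : Adj G s s′
    s~s′ = rot-Adj s~p refl

    qsOut⊆Out⁺ : q ∷ s ∷ Out ⊆ Out⁺
    qsOut⊆Out⁺ (here e) = here e
    qsOut⊆Out⁺ (there (here e)) = there (here e)
    qsOut⊆Out⁺ (there (there m)) = there (there (there (there m)))

    exit : ∀ {a b} → a ∈ Out⁺ → Adj G a b → b ∈ Out⁺ ⊎ (a ≡ q × b ≡ q′) ⊎ (a ≡ s × b ≡ s′)
    exit (here refl) qb with neighbour q-rotation qb
    ... | here b≡p = inj₁ (there (there (here b≡p)))
    ... | there (here b≡r) = inj₁ (there (there (there (here b≡r))))
    ... | there (there (here b≡q′)) = inj₂ (inj₁ (refl , b≡q′))
    exit (there (here refl)) sb with neighbour s-rotation sb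
    ... | here b≡r = inj₁ (there (there (there (here b≡r))))
    ... | there (here b≡p) = inj₁ (there (there (here b≡p)))
    ... | there (there (here b≡s′)) = inj₂ (inj₂ (refl , b≡s′))
    exit (there (there (here refl))) pb = inj₁ (qsOut⊆Out⁺ (p-neighbour pb))
    exit (there (there (there (here refl)))) rb = inj₁ (qsOut⊆Out⁺ (r-neighbour rb))
    exit (there (there (there (there a∈Out)))) ab =
      inj₁ (there (there (Out-neighbour a∈Out ab)))

    exit⁺ : ∀ {a b} → a ∈ Out⁺ → Adj G a b → b ∈ q′ ∷ s′ ∷ Out⁺
    exit⁺ a∈ ab with exit a∈ ab
    ... | inj₁ b∈ = there (there b∈)
    ... | inj₂ (inj₁ (_ , b≡q′)) = here b≡q′
    ... | inj₂ (inj₂ (_ , b≡s′)) = there (here b≡s′)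

    entry : ∀ {a b} → b ∈ p ∷ r ∷ Out → Adj G a b → a ∈ Out⁺
    entry (here refl) ab = qsOut⊆Out⁺ (p-neighbour (Adj-sym ab))
    entry (there (here refl)) ab = qsOut⊆Out⁺ (r-neighbour (Adj-sym ab))
    entry (there (there b∈Out)) ab = there (there (Out-neighbour b∈Out (Adj-sym ab)))

    neighbour-∉Out⁺ : ∀ {a b} → a ∉ Out⁺ → Adj G a b → b ≢ q → b ≢ s → b ∉ Out⁺
    neighbour-∉Out⁺ a∉ ab b≢q b≢s (here b≡q) = b≢q b≡q
    neighbour-∉Out⁺ a∉ ab b≢q b≢s (there (here b≡s)) = b≢s b≡s
    neighbour-∉Out⁺ a∉ ab b≢q b≢s (there (there b∈)) = a∉ (entry b∈ ab)

    q′∉ : q′ ∉ p ∷ r ∷ Out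
    q′∉ (here q′≡p) = a≢c q-rotation (sym q′≡p)
    q′∉ (there (here q′≡r)) = b≢c q-rotation (sym q′≡r)
    q′∉ (there (there q′∈Out)) = q∉ (there (Out-neighbour q′∈Out (Adj-sym q~q′)))

    s′∉ : s′ ∉ p ∷ r ∷ Out
    s′∉ (here s′≡p) = b≢c s-rotation (sym s′≡p)
    s′∉ (there (here s′≡r)) = a≢c s-rotation (sym s′≡r)
    s′∉ (there (there s′∈Out)) = s∉ (Out-neighbour s′∈Out (Adj-sym s~s′))

    q′-cubic : deg G q′ ≡ 3
    q′-cubic = cubic q′∉

    s′-cubic : deg G s′ ≡ 3
    s′-cubic = cubic s′∉

    close : PathOutside (p ∷ r ∷ Out) q s → PathOutside Out p r
    close = append (Adj-sym r~s) ∘ prepend p~q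

    extend : PathOutside Out⁺ q′ s′ → PathOutside Out p r
    extend = close ∘ append (Adj-sym s~s′) ∘ prepend q~q′

    diagonal : s′ ≡ q → PathOutside Out p r
    diagonal s′≡q = close record
      { inner = [] ; linked = q~s ∷ [-] ; unique = unique
      ; covers = λ v → closed-along-walk (_∈ Out⁺) closed (connected q v) (here refl)
      }
      where
      q~s : Adj G q s
      q~s = Adj-sym (subst (Adj G s) s′≡q s~s′)
      q′≡s : q′ ≡ s
      q′≡s with neighbour q-rotation q~s
      ... | here s≡p = ⊥-elim (s∉ (here s≡p))
      ... | there (here s≡r) = ⊥-elim (s∉ (there (here s≡r)))
      ... | there (there (here s≡q′)) = sym s≡q′
      closed : ∀ {a b} → a ∈ Out⁺ → ⊤ → Adj G a b → b ∈ Out⁺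
      closed a∈ _ ab with exit a∈ ab
      ... | inj₁ b∈ = b∈
      ... | inj₂ (inj₁ (_ , b≡q′)) = there (here (trans b≡q′ q′≡s))
      ... | inj₂ (inj₂ (_ , b≡s′)) = here (trans b≡s′ s′≡q)

    module OffDiagonal (s′≢q : s′ ≢ q) where

      q′≢s : q′ ≢ s
      q′≢s q′≡s with neighbour s-rotation (Adj-sym (subst (Adj G q) q′≡s q~q′))
      ... | here q≡r = q∉ (there (there (here q≡r)))
      ... | there (here q≡p) = q∉ (there (here q≡p))
      ... | there (there (here q≡s′)) = s′≢q (sym q≡s′)

      q′∉Out⁺ : q′ ∉ Out⁺
      q′∉Out⁺ (here q′≡q) = Adj-irrefl q~q′ (sym q′≡q)
      q′∉Out⁺ (there (here q′≡s)) = q′≢s q′≡s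
      q′∉Out⁺ (there (there q′∈)) = q′∉ q′∈

      s′∉Out⁺ : s′ ∉ Out⁺
      s′∉Out⁺ (here s′≡q) = s′≢q s′≡q
      s′∉Out⁺ (there (here s′≡s)) = Adj-irrefl s~s′ (sym s′≡s)
      s′∉Out⁺ (there (there s′∈)) = s′∉ s′∈

      q′≢s′ : q′ ≢ s′
      q′≢s′ q′≡s′ =
        no-cubic-attachment (_∈ Out⁺) cubic⁺ (here refl) (there (here refl)) q≢s q′∉Out⁺
          (Adj-sym q~q′) (Adj-sym (subst (Adj G s) (sym q′≡s′) s~s′)) leaves
        where
        leaves : ∀ {c d} → c ∈ Out⁺ → Adj G c d → d ∈ Out⁺ ⊎ (d ≡ q′ × c ∈ q ∷ s ∷ [])
        leaves c∈ cd with exit c∈ cd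
        ... | inj₁ d∈ = inj₁ d∈
        ... | inj₂ (inj₁ (c≡q , d≡q′)) = inj₂ (d≡q′ , here c≡q)
        ... | inj₂ (inj₂ (c≡s , d≡s′)) = inj₂ (trans d≡s′ (sym q′≡s′) , there (here c≡s))

      no-pentagon-beside-hexagon : ∀ {t} → Adj G q′ s′ → Adj G q′ t → Adj G s′ t →
                                   t ≢ q → t ≢ s → ⊥
      no-pentagon-beside-hexagon {t} q′~s′ q′~t s′~t t≢q t≢s =
        no-cubic-attachment (_∈ q′ ∷ s′ ∷ Out⁺) (cubic⁺ ∘ (_∘ there ∘ there)) (here refl)
          (there (here refl)) (Adj-irrefl q′~s′) t∉ (Adj-sym q′~t) (Adj-sym s′~t) leaves
        where
        t∉ : t ∉ q′ ∷ s′ ∷ Out⁺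
        t∉ (here t≡q′) = Adj-irrefl q′~t (sym t≡q′)
        t∉ (there (here t≡s′)) = Adj-irrefl s′~t (sym t≡s′)
        t∉ (there (there t∈)) = neighbour-∉Out⁺ q′∉Out⁺ q′~t t≢q t≢s t∈
        leaves : ∀ {c d} → c ∈ q′ ∷ s′ ∷ Out⁺ → Adj G c d →
                 d ∈ q′ ∷ s′ ∷ Out⁺ ⊎ (d ≡ t × c ∈ q′ ∷ s′ ∷ [])
        leaves (here refl) q′d
          with neighbour₃ q′-cubic (s′≢q ∘ sym) (t≢q ∘ sym) (Adj-irrefl s′~t)
                 (Adj-sym q~q′) q′~s′ q′~t q′d
        ... | here d≡q = inj₁ (there (there (here d≡q)))
        ... | there (here d≡s′) = inj₁ (there (here d≡s′))
        ... | there (there (here d≡t)) = inj₂ (d≡t , here refl)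
        leaves (there (here refl)) s′d
          with neighbour₃ s′-cubic (q′≢s ∘ sym) (t≢s ∘ sym) (Adj-irrefl q′~t)
                 (Adj-sym s~s′) (Adj-sym q′~s′) s′~t s′d
        ... | here d≡s = inj₁ (there (there (there (here d≡s))))
        ... | there (here d≡q′) = inj₁ (here d≡q′)
        ... | there (there (here d≡t)) = inj₂ (d≡t , there (here refl))
        leaves (there (there c∈)) cd = inj₁ (exit⁺ c∈ cd)

      next-frame : ∀ {t t′} →
                   ρ s′ s ≡ t → ρ t s′ ≡ q′ → ρ q′ t ≡ q →
                   ρ q′ q ≡ t′ → ρ t′ q′ ≡ s′ → ρ s′ t′ ≡ s →
                   Frame Out⁺ q′ t′ s′ t
      next-frame {t} {t′} x₁ x₂ x₃ z₁ z₂ z₃ = record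
        { p~q = q′~t′ ; q~r = t′~s′ ; r~s = s′~t ; s~p = t~q′
        ; ρpq = ρc≡a q′-rotation ; ρqp = z₂ ; ρrs = ρc≡a s′-rotation ; ρsr = x₂
        ; unique = (t′≢t ∷ Adj-irrefl q′~t′ ∘ sym ∷ Adj-irrefl t′~s′ ∷ ¬Any⇒All¬ _ t′∉Out⁺)
                   ∷ (Adj-irrefl t~q′ ∷ Adj-irrefl s′~t ∘ sym ∷ ¬Any⇒All¬ _ t∉Out⁺)
                   ∷ (q′≢s′ ∷ ¬Any⇒All¬ _ q′∉Out⁺) ∷ ¬Any⇒All¬ _ s′∉Out⁺ ∷ unique
        ; p-neighbour = q′-neighbour
        ; r-neighbour = s′-neighbour
        ; Out-neighbour = exit⁺
        ; cubic = cubic⁺ ∘ (_∘ there ∘ there)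
        }
        where
        q′~t′ = rot-Adj (Adj-sym q~q′) z₁
        s′~t = rot-Adj (Adj-sym s~s′) x₁
        t′~s′ = Adj-next q′~t′ z₂
        t~q′ = Adj-next s′~t x₂
        q′-rotation : Rotation₃ q′ t q t′
        q′-rotation = rotation₃ q′-cubic (Adj-sym t~q′) x₃ z₁
        s′-rotation : Rotation₃ s′ t′ s t
        s′-rotation = rotation₃ s′-cubic (Adj-sym t′~s′) z₃ x₁
        t′≢t : t′ ≢ t
        t′≢t = a≢c s′-rotation
        t∉Out⁺ : t ∉ Out⁺
        t∉Out⁺ =
          neighbour-∉Out⁺ q′∉Out⁺ (Adj-sym t~q′) (a≢b q′-rotation) (b≢c s′-rotation ∘ sym)
        t′∉Out⁺ : t′ ∉ Out⁺
        t′∉Out⁺ = neighbour-∉Out⁺ q′∉Out⁺ q′~t′ (b≢c q′-rotation ∘ sym) (a≢b s′-rotation)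
        q′-neighbour : ∀ {b} → Adj G q′ b → b ∈ t′ ∷ t ∷ Out⁺
        q′-neighbour q′b with neighbour q′-rotation q′b
        ... | here b≡t = there (here b≡t)
        ... | there (here b≡q) = there (there (here b≡q))
        ... | there (there (here b≡t′)) = here b≡t′
        s′-neighbour : ∀ {b} → Adj G s′ b → b ∈ t′ ∷ t ∷ Out⁺
        s′-neighbour s′b with neighbour s′-rotation s′b
        ... | here b≡t′ = here b≡t′
        ... | there (here b≡s) = there (there (there (here b≡s)))
        ... | there (there (here b≡t)) = there (here b≡t)

    peel : (∀ {a b c d} → Frame Out⁺ a b c d → PathOutside Out⁺ a c) →
           PathOutside Out p r
    peel recurse with s′ ≟ q
    ... | yes s′≡q = diagonal s′≡q
    ... | no s′≢q = by-faces
      (small-face faces≤6 (Adj-sym q~q′) (ρc≡a q-rotation) ρpq (q≢s ∘ sym))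
      (small-face faces≤6 (Adj-sym s~s′) (ρc≡a s-rotation) ρrs q≢s)
      where
      open OffDiagonal s′≢q
      by-faces : SmallFace q′ q p s → SmallFace s′ s r q → PathOutside Out p r
      by-faces (triangle s′≡q) _ = ⊥-elim (s′≢q s′≡q)
      by-faces (quadrangle s′≡q′) _ = ⊥-elim (q′≢s′ (sym s′≡q′))
      by-faces _ (triangle q′≡s) = ⊥-elim (q′≢s q′≡s)
      by-faces _ (quadrangle q′≡s′) = ⊥-elim (q′≢s′ q′≡s′)
      by-faces (pentagon x₁ _) (pentagon _ z₂) =
        ⊥-elim (a≢c (rotation₃ s′-cubic (Adj-sym s~s′) x₁ z₂) refl)
      by-faces (pentagon x₁ _) (hexagon t′ z₁ z₂ z₃) =
        ⊥-elim (no-pentagon-beside-hexagon q′~s′ q′~t′ s′~t′ t′≢q t′≢s)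
        where
        q′~s′ = Adj-sym (rot-Adj (Adj-sym s~s′) x₁)
        q′~t′ = rot-Adj (Adj-sym q~q′) z₁
        s′~t′ = Adj-sym (Adj-next q′~t′ z₂)
        t′≢q = a≢b (rotation₃ q′-cubic (Adj-sym q~q′) z₁ refl) ∘ sym
        t′≢s = a≢b (rotation₃ s′-cubic s′~t′ z₃ refl)
      by-faces (hexagon t x₁ x₂ x₃) (pentagon z₁ _) =
        ⊥-elim (no-pentagon-beside-hexagon q′~s′ q′~t s′~t t≢q t≢s)
        where
        q′~s′ = rot-Adj (Adj-sym q~q′) z₁
        s′~t = rot-Adj (Adj-sym s~s′) x₁
        q′~t = Adj-sym (Adj-next s′~t x₂)
        t≢q = a≢b (rotation₃ q′-cubic q′~t x₃ refl)
        t≢s = a≢b (rotation₃ s′-cubic (Adj-sym s~s′) x₁ refl) ∘ sym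
      by-faces (hexagon t x₁ x₂ x₃) (hexagon t′ z₁ z₂ z₃) =
        extend (recurse (next-frame x₁ x₂ x₃ z₁ z₂ z₃))

  quad-frame : ∀ {x y z w} → QuadFace R x y z w → deg G x ≡ 2 → deg G z ≡ 2 →
               (∀ v → v ≢ x → v ≢ z → deg G v ≡ 3) → Frame [] x y z w
  quad-frame {x} {y} {z} {w}
    (x≢y , x≢z , x≢w , y≢z , y≢w , z≢w , x~y , y~z , z~w , w~x , xy→yz , yz→zw , zw→wx , wx→xy)
    deg-x deg-z cubic = record
    { p~q = x~y ; q~r = y~z ; r~s = z~w ; s~p = w~x
    ; ρpq = ρxy≡w ; ρqp = cong proj₂ xy→yz ; ρrs = ρzw≡y ; ρsr = cong proj₂ zw→wx
    ; unique = (y≢w ∷ x≢y ∘ sym ∷ y≢z ∷ []) ∷ (x≢w ∘ sym ∷ z≢w ∘ sym ∷ []) ∷ (x≢z ∷ [])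
               ∷ [] ∷ []
    ; p-neighbour = x-neighbour
    ; r-neighbour = z-neighbour
    ; Out-neighbour = λ ()
    ; cubic = λ v∉ → cubic _ (v∉ ∘ here) (v∉ ∘ there ∘ here)
    }
    where
    x-neighbour : ∀ {b} → Adj G x b → b ∈ y ∷ w ∷ []
    x-neighbour =
      all-neighbours ((y≢w ∷ []) ∷ [] ∷ []) (x~y ∷ Adj-sym w~x ∷ []) (≤-reflexive deg-x)
    z-neighbour : ∀ {b} → Adj G z b → b ∈ y ∷ w ∷ []
    z-neighbour =
      all-neighbours ((y≢w ∷ []) ∷ [] ∷ []) (Adj-sym y~z ∷ z~w ∷ []) (≤-reflexive deg-z)
    ρxy≡w : ρ x y ≡ w
    ρxy≡w with x-neighbour (rot-Adj x~y refl)
    ... | here ρxy≡y =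
      ⊥-elim (y≢w (rot-injective x~y (Adj-sym w~x) (trans ρxy≡y (sym (cong proj₂ wx→xy)))))
    ... | there (here ρxy≡w) = ρxy≡w
    ρzw≡y : ρ z w ≡ y
    ρzw≡y with z-neighbour (rot-Adj z~w refl)
    ... | here ρzw≡y = ρzw≡y
    ... | there (here ρzw≡w) =
      ⊥-elim (y≢w (sym (rot-injective z~w (Adj-sym y~z)
                                      (trans ρzw≡w (sym (cong proj₂ yz→zw))))))

  frame-path : ∀ k {Out p q r s} → n ≤ length Out + k → Frame Out p q r s →
               PathOutside Out p r
  frame-path zero {Out} n≤ F =
    ⊥-elim (1+n≰n (≤-trans (m≤n+m (suc (length Out)) 3)
                           (≤-trans (length-Unique-Fin (Frame.unique F))
                                    (≤-trans n≤ (≤-reflexive (+-identityʳ (length Out)))))))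
  frame-path (suc k) {Out} n≤ F = Step.peel F (frame-path k n≤′)
    where
    n≤′ : n ≤ 4 + length Out + k
    n≤′ = ≤-trans n≤ (≤-trans (≤-reflexive (+-suc (length Out) k)) (m≤n+m _ 3))

lemma8 : {n : ℕ} (G : Graph n) (E : PlaneEmbedding G) (x y z w : Fin n) →
    TwoConnected G →
    FacesAtMost (rs E) 6 →
    outer E ≡ (x , y) →
    QuadFace (rs E) x y z w →
    deg G x ≡ 2 → deg G z ≡ 2 →
    (∀ v → v ≢ x → v ≢ z → deg G v ≡ 3) →
    HamiltonianPath G x z
lemma8 {n} G E x y z w (_ , connected , no-cut-vertex) faces≤6 _ quad deg-x deg-z cubic =
  HamiltonianPathOutside⇒HamiltonianPath G
    (frame-path n ≤-refl (quad-frame quad deg-x deg-z cubic))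
  where open Frames G (rs E) connected no-cut-vertex faces≤6
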